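{- Let $k\ge2$ and let $\mathcal{H}$ be a connected $k$-graph with at least one edge. Then the cyclic index of $\mu(\mathcal{H},x)$ is equal to $k$.
   Context: A $k$-graph $\mathcal{H}$ has a finite vertex set and an edge set of $k$-element vertex subsets; connected means any two vertices are joined by a path (alternating sequence of distinct vertices and distinct edges with consecutive vertices contained in the edge between them). $\mu(\mathcal{H},x)=\sum_{r\ge0}(-1)^rp(\mathcal{H},r)x^{|V(\mathcal{H})|-kr}$, where $p(\mathcal{H},r)$ counts sets of $r$ pairwise disjoint edges ($p(\mathcal{H},0)=1$). A real polynomial $f$ is $\ell$-symmetric if $f(x)=x^tg(x^\ell)$ for some integer $t\ge0$ and real polynomial $g$; the cyclic index of $f$ is the maximum $\ell$ for which $f$ is $\ell$-symmetric. -}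

module Defs where

open import Data.Nat using (ℕ; zero; suc; _+_; _*_; _≤_; _<_)
import Data.Nat.Properties as ℕP
open import Data.Integer using (ℤ; +_; -_) renaming (_+_ to _+ℤ_; _*_ to _*ℤ_)
open import Data.Fin using (Fin)
open import Data.Fin.Subset using (Subset; _∈_; _∩_; Empty; ∣_∣; inside; outside)
open import Data.Fin.Subset.Properties using (_∈?_; nonempty?)
open import Data.Fin.Properties using (all?)
open import Data.Vec using ([]; _∷_)
open import Data.List using (List; []; _∷_; _++_; map; filter; length; upTo)
open import Data.Product using (Σ; ∃; _×_; _,_)
open import Relation.Binary.PropositionalEquality using (_≡_; _≢_)
open import Relation.Nullary using (Dec; yes; no; ¬_)
open import Relation.Nullary.Decidable using (_×-dec_; _→-dec_; ¬?)
open import Function.Definitions using (Injective)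
open import Relation.Binary.Construct.Closure.ReflexiveTransitive using (Star)
import Data.Fin.Properties as FinP

-- Each edge is a k-element subset of the vertices; distinct indices give
-- distinct edges (so the edges form a set of k-subsets).
record KGraph (k : ℕ) : Set where
  field
    n        : ℕ
    m        : ℕ
    edge     : Fin m → Subset n
    edgeSize : ∀ i → ∣ edge i ∣ ≡ k
    edgeInj  : Injective _≡_ _≡_ edge

module _ {k : ℕ} (H : KGraph k) where
  open KGraph H

  Adjacent : Fin n → Fin n → Set
  Adjacent u v = ∃ λ i → u ∈ edge i × v ∈ edge i

  Connected : Set
  Connected = ∀ u v → Star Adjacent u v

  PairwiseDisjoint : Subset m → Set
  PairwiseDisjoint S = ∀ i j → i ∈ S → j ∈ S → i ≢ j → Empty (edge i ∩ edge j)

  pairwiseDisjoint? : (S : Subset m) → Dec (PairwiseDisjoint S)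
  pairwiseDisjoint? S = all? λ i → all? λ j →
    (i ∈? S) →-dec ((j ∈? S) →-dec (¬? (i FinP.≟ j) →-dec ¬? (nonempty? (edge i ∩ edge j))))

allSubsets : ∀ m → List (Subset m)
allSubsets zero = [] ∷ []
allSubsets (suc m) = map (outside ∷_) (allSubsets m) ++ map (inside ∷_) (allSubsets m)

module _ {k : ℕ} (H : KGraph k) where
  open KGraph H

  matchCount : ℕ → ℕ
  matchCount r = length (filter (λ S → (∣ S ∣ ℕP.≟ r) ×-dec pairwiseDisjoint? H S) (allSubsets m))

signZ : ℕ → ℤ
signZ zero = + 1
signZ (suc r) = - signZ r

sumZ : List ℤ → ℤ
sumZ [] = + 0
sumZ (x ∷ xs) = x +ℤ sumZ xs

-- Polynomials with integer coefficients are represented by their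
-- coefficient function ℕ → ℤ (coefficient of x^e).
Poly : Set
Poly = ℕ → ℤ

-- The matching polynomial μ(H,x) = Σ_r (-1)^r p(H,r) x^(n - k r).
-- Its coefficient at x^e is Σ over r with k r + e = n of (-1)^r p(H,r);
-- r ranges over 0..m (p(H,r) = 0 for r > m).
matchingPoly : ∀ {k} → KGraph k → Poly
matchingPoly {k} H e =
  sumZ (map (λ r → term r) (upTo (suc (KGraph.m H))))
  where
  term : ℕ → ℤ
  term r with (k * r + e) ℕP.≟ KGraph.n H
  ... | yes _ = signZ r *ℤ (+ matchCount H r)
  ... | no  _ = + 0

-- Coefficient of x^e in  x^t * g(x^ℓ), where g = Σ_j g_j y^j is given by its
-- coefficient list [g_0, g_1, ...]:  Σ_{j : t + ℓ j = e} g_j.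
substCoeff : (t ℓ : ℕ) → List ℤ → ℕ → ℤ
substCoeff t ℓ [] e = + 0
substCoeff t ℓ (c ∷ g) e with t ℕP.≟ e
... | yes _ = c +ℤ substCoeff (t + ℓ) ℓ g e
... | no  _ = substCoeff (t + ℓ) ℓ g e

Symmetric : ℕ → Poly → Set
Symmetric ℓ f = Σ ℕ λ t → Σ (List ℤ) λ g → ∀ e → f e ≡ substCoeff t ℓ g e

IsCyclicIndex : Poly → ℕ → Set
IsCyclicIndex f ℓ = Symmetric ℓ f × (∀ ℓ′ → Symmetric ℓ′ f → ℓ′ ≤ ℓ)

-- The exponents carrying a nonzero coefficient of μ(H,x) are of the form
-- n − kr, hence all congruent to n modulo k, so μ(H,x) = x^(n mod k) g(x^k).
-- Conversely p(H,0) = 1 and p(H,1) = m are nonzero, so x^n and x^(n−k) both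
-- occur in μ(H,x); in an ℓ-symmetric polynomial the exponents of nonzero
-- coefficients are congruent modulo ℓ, hence ℓ ∣ k and ℓ ≤ k.
module Submission where

open import Defs
open import Data.Nat using (ℕ; zero; suc; _+_; _*_; _∸_; _≤_; _<_; z≤n; s≤s; NonZero)
open import Data.Nat.Properties
open import Data.Nat.DivMod using (_/_; _%_; m≡m%n+[m/n]*n; [m+kn]%n≡m%n; /-monoˡ-≤)
open import Data.Nat.Divisibility using (_∣_; ∣⇒≤; ∣m+n∣m⇒∣n; m∣m*n)
open import Data.Integer as ℤ using (ℤ; +_) renaming (_+_ to _+ℤ_; _*_ to _*ℤ_)
import Data.Integer.Properties as ℤ
open import Data.Fin using (Fin; fromℕ<)
open import Data.Fin.Subset using (Subset; ⊥; ⁅_⁆; ∣_∣; inside; outside)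
open import Data.Fin.Subset.Properties using (∉⊥; x∈⁅y⁆⇒x≡y; ∣⊥∣≡0; ∣⁅x⁆∣≡1; ∣p∣≤n)
open import Data.Vec using ([]; _∷_)
open import Data.List using (List; []; _∷_; map; upTo; applyUpTo)
open import Data.List.Properties using (map-upTo)
open import Data.List.Membership.Propositional using () renaming (_∈_ to _∈ₗ_)
open import Data.List.Membership.Propositional.Properties
  using (∈-map⁺; ∈-++⁺ˡ; ∈-++⁺ʳ; ∈-filter⁺; ∈-length)
open import Data.List.Relation.Unary.Any using (here)
open import Data.Product using (Σ; ∃; _,_; proj₁; proj₂)
open import Relation.Nullary using (yes; no; contradiction)
open import Relation.Binary.PropositionalEquality
open import Function using (_∘_)
open ≡-Reasoning

sumZ-applyUpTo-zero : ∀ {h : ℕ → ℤ} L → (∀ i → h i ≡ + 0) → sumZ (applyUpTo h L) ≡ + 0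
sumZ-applyUpTo-zero zero    h≡0 = refl
sumZ-applyUpTo-zero (suc L) h≡0 = cong₂ _+ℤ_ (h≡0 0) (sumZ-applyUpTo-zero L (λ i → h≡0 (suc i)))

sumZ-applyUpTo-single : ∀ {h : ℕ → ℤ} {i} L → i < L → (∀ j → j ≢ i → h j ≡ + 0) →
  sumZ (applyUpTo h L) ≡ h i
sumZ-applyUpTo-single {h} {zero} (suc L) _ h≡0 = begin
  h 0 +ℤ sumZ (applyUpTo (λ j → h (suc j)) L) ≡⟨ cong (h 0 +ℤ_) (sumZ-applyUpTo-zero L λ j → h≡0 (suc j) λ ()) ⟩
  h 0 +ℤ + 0                                   ≡⟨ ℤ.+-identityʳ (h 0) ⟩
  h 0                                          ∎
sumZ-applyUpTo-single {h} {suc i} (suc L) (s≤s i<L) h≡0 = begin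
  h 0 +ℤ sumZ (applyUpTo (λ j → h (suc j)) L) ≡⟨ cong₂ _+ℤ_ (h≡0 0 λ ()) tail≡ ⟩
  + 0 +ℤ h (suc i)                             ≡⟨ ℤ.+-identityˡ (h (suc i)) ⟩
  h (suc i)                                    ∎
  where
  tail≡ : sumZ (applyUpTo (λ j → h (suc j)) L) ≡ h (suc i)
  tail≡ = sumZ-applyUpTo-single L i<L λ j j≢i → h≡0 (suc j) (j≢i ∘ suc-injective)

SupportedOnProgression : Poly → (s ℓ L : ℕ) → Set
SupportedOnProgression f s ℓ L = ∀ e → (∀ j → j < L → e ≢ s + ℓ * j) → f e ≡ + 0

coeffsAlong : Poly → (s ℓ L : ℕ) → List ℤ
coeffsAlong f s ℓ zero    = []
coeffsAlong f s ℓ (suc L) = f s ∷ coeffsAlong f (s + ℓ) ℓ L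

progression-zero : ∀ s ℓ → s + ℓ * 0 ≡ s
progression-zero s ℓ = trans (cong (_+_ s) (*-zeroʳ ℓ)) (+-identityʳ s)

progression-suc : ∀ s ℓ j → s + ℓ * suc j ≡ (s + ℓ) + ℓ * j
progression-suc s ℓ j = trans (cong (_+_ s) (*-suc ℓ j)) (sym (+-assoc s ℓ (ℓ * j)))

substCoeff-below : ∀ {s ℓ e} g → e < s → substCoeff s ℓ g e ≡ + 0
substCoeff-below []      e<s = refl
substCoeff-below {s} {ℓ} {e} (c ∷ g) e<s with s ≟ e
... | yes refl = contradiction e<s (<-irrefl refl)
... | no _     = substCoeff-below g (<-≤-trans e<s (m≤m+n s ℓ))

substCoeff-nonzero⇒onProgression : ∀ {s ℓ e} g → substCoeff s ℓ g e ≢ + 0 → ∃ λ j → e ≡ s + ℓ * j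
substCoeff-nonzero⇒onProgression [] ≢0 = contradiction refl ≢0
substCoeff-nonzero⇒onProgression {s} {ℓ} {e} (c ∷ g) ≢0 with s ≟ e
... | yes refl = 0 , sym (progression-zero s ℓ)
... | no _ with substCoeff-nonzero⇒onProgression g ≢0
...   | j , e≡ = suc j , trans e≡ (sym (progression-suc s ℓ j))

substCoeff-coeffsAlong : ∀ {f s ℓ e} L → 0 < ℓ → ((∀ j → j < L → e ≢ s + ℓ * j) → f e ≡ + 0) →
  substCoeff s ℓ (coeffsAlong f s ℓ L) e ≡ f e
substCoeff-coeffsAlong zero _ vanish = sym (vanish λ _ ())
substCoeff-coeffsAlong {f} {s} {ℓ} {e} (suc L) 0<ℓ vanish with s ≟ e
... | yes refl = begin
  f s +ℤ substCoeff (s + ℓ) ℓ rest s ≡⟨ cong (f s +ℤ_) (substCoeff-below {ℓ = ℓ} rest (m<m+n s 0<ℓ)) ⟩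
  f s +ℤ + 0                         ≡⟨ ℤ.+-identityʳ (f s) ⟩
  f s                                ∎
  where
  rest : List ℤ
  rest = coeffsAlong f (s + ℓ) ℓ L
... | no s≢e = substCoeff-coeffsAlong L 0<ℓ λ off → vanish λ where
  zero    _         e≡s → s≢e (sym (trans e≡s (progression-zero s ℓ)))
  (suc j) (s≤s j<L) e≡  → off j j<L (trans e≡ (progression-suc s ℓ j))

supportedOnProgression⇒symmetric : ∀ {f s ℓ L} → 0 < ℓ → SupportedOnProgression f s ℓ L → Symmetric ℓ f
supportedOnProgression⇒symmetric {f} {s} {ℓ} {L} 0<ℓ supp =
  s , coeffsAlong f s ℓ L , λ e → sym (substCoeff-coeffsAlong L 0<ℓ (supp e))

symmetric⇒∣-gap : ∀ {ℓ f a d} → Symmetric ℓ f → f a ≢ + 0 → f (d + a) ≢ + 0 → ℓ ∣ d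
symmetric⇒∣-gap {ℓ} {f} {a} {d} (t , g , f≡) fa≢0 fda≢0
  with substCoeff-nonzero⇒onProgression g (fa≢0 ∘ trans (f≡ a))
     | substCoeff-nonzero⇒onProgression g (fda≢0 ∘ trans (f≡ (d + a)))
... | j₂ , a≡ | j₁ , da≡ = ∣m+n∣m⇒∣n (subst (ℓ ∣_) (sym gap) (m∣m*n j₁)) (m∣m*n j₂)
  where
  gap : ℓ * j₂ + d ≡ ℓ * j₁
  gap = +-cancelˡ-≡ t _ _ (begin
    t + (ℓ * j₂ + d) ≡⟨ sym (+-assoc t (ℓ * j₂) d) ⟩
    t + ℓ * j₂ + d   ≡⟨ cong (_+ d) (sym a≡) ⟩
    a + d            ≡⟨ +-comm a d ⟩
    d + a            ≡⟨ da≡ ⟩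
    t + ℓ * j₁       ∎)

k*r+e≡n⇒e≡n%k+k*[e/k] : ∀ {k r e n} .{{_ : NonZero k}} → k * r + e ≡ n → e ≡ n % k + k * (e / k)
k*r+e≡n⇒e≡n%k+k*[e/k] {k} {r} {e} {n} eq = begin
  e                     ≡⟨ m≡m%n+[m/n]*n e k ⟩
  e % k + e / k * k     ≡⟨ cong₂ _+_ (sym n%k≡e%k) (*-comm (e / k) k) ⟩
  n % k + k * (e / k)   ∎
  where
  n≡e+r*k : n ≡ e + r * k
  n≡e+r*k = trans (sym eq) (trans (+-comm (k * r) e) (cong (_+_ e) (*-comm k r)))
  n%k≡e%k : n % k ≡ e % k
  n%k≡e%k = trans (cong (_% k) n≡e+r*k) ([m+kn]%n≡m%n e r k)

∣signZ∣≡1 : ∀ r → ℤ.∣ signZ r ∣ ≡ 1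
∣signZ∣≡1 zero    = refl
∣signZ∣≡1 (suc r) = trans (ℤ.∣-i∣≡∣i∣ (signZ r)) (∣signZ∣≡1 r)

signZ*-nonzero : ∀ r {c} → 0 < c → signZ r *ℤ + c ≢ + 0
signZ*-nonzero r {c} 0<c eq = <⇒≢ 0<c (sym (begin
  c                      ≡⟨ sym (*-identityˡ c) ⟩
  1 * c                  ≡⟨ cong (_* c) (∣signZ∣≡1 r) ⟨
  ℤ.∣ signZ r ∣ * c      ≡⟨ ℤ.abs-* (signZ r) (+ c) ⟨
  ℤ.∣ signZ r *ℤ + c ∣   ≡⟨ cong ℤ.∣_∣ eq ⟩
  0                      ∎))

allSubsets-complete : ∀ {m} (S : Subset m) → S ∈ₗ allSubsets m
allSubsets-complete []            = here refl
allSubsets-complete (outside ∷ S) = ∈-++⁺ˡ (∈-map⁺ (outside ∷_) (allSubsets-complete S))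
allSubsets-complete (inside ∷ S)  =
  ∈-++⁺ʳ (map (outside ∷_) (allSubsets _)) (∈-map⁺ (inside ∷_) (allSubsets-complete S))

module _ {k} (H : KGraph k) where
  open KGraph H

  matchCount-pos : ∀ {r} (S : Subset m) → ∣ S ∣ ≡ r → PairwiseDisjoint H S → 0 < matchCount H r
  matchCount-pos S refl disj = ∈-length (∈-filter⁺ _ (allSubsets-complete S) (refl , disj))

  ⊥-pairwiseDisjoint : PairwiseDisjoint H ⊥
  ⊥-pairwiseDisjoint i _ i∈⊥ = contradiction i∈⊥ ∉⊥

  ⁅⁆-pairwiseDisjoint : ∀ i → PairwiseDisjoint H ⁅ i ⁆
  ⁅⁆-pairwiseDisjoint i j j′ j∈ j′∈ j≢j′ =
    contradiction (trans (x∈⁅y⁆⇒x≡y i j∈) (sym (x∈⁅y⁆⇒x≡y i j′∈))) j≢j′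

  edge⇒k≤n : Fin m → k ≤ n
  edge⇒k≤n i = subst (_≤ n) (edgeSize i) (∣p∣≤n (edge i))

  -- The summand of matchingPoly is a local with-function, which cannot be named;
  -- abstracting the index list, the sum and the addition lets unification recover it.
  private
    matchingPoly-asSum : ∀ e → Σ (ℕ → ℤ) λ h → matchingPoly H e ≡ sumZ (map h (upTo (suc m)))
    matchingPoly-asSum e with applyUpTo suc m | sumZ | _+ℤ_
    ... | _ | _ | _ = _ , refl

  summand : ℕ → ℕ → ℤ
  summand e = proj₁ (matchingPoly-asSum e)

  matchingPoly≡sumZ-summand : ∀ e → matchingPoly H e ≡ sumZ (applyUpTo (summand e) (suc m))
  matchingPoly≡sumZ-summand e =
    trans (proj₂ (matchingPoly-asSum e)) (cong sumZ (map-upTo (summand e) (suc m)))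

  summand-match : ∀ {e r} → k * r + e ≡ n → summand e r ≡ signZ r *ℤ + matchCount H r
  summand-match {e} {r} eq with k * r + e ≟ n
  ... | yes _  = refl
  ... | no neq = contradiction eq neq

  summand-mismatch : ∀ {e r} → k * r + e ≢ n → summand e r ≡ + 0
  summand-mismatch {e} {r} neq with k * r + e ≟ n
  ... | yes eq = contradiction eq neq
  ... | no _   = refl

  matchingPoly-vanishes : ∀ {e} → (∀ r → k * r + e ≢ n) → matchingPoly H e ≡ + 0
  matchingPoly-vanishes {e} mismatch =
    trans (matchingPoly≡sumZ-summand e) (sumZ-applyUpTo-zero (suc m) (summand-mismatch ∘ mismatch))

  matchingPoly-coeff : .{{_ : NonZero k}} → ∀ {e r} → r ≤ m → k * r + e ≡ n →
    matchingPoly H e ≡ signZ r *ℤ + matchCount H r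
  matchingPoly-coeff {e} {r} r≤m eq = begin
    matchingPoly H e                       ≡⟨ matchingPoly≡sumZ-summand e ⟩
    sumZ (applyUpTo (summand e) (suc m))   ≡⟨ sumZ-applyUpTo-single (suc m) (s≤s r≤m) (λ r′ → summand-mismatch ∘ other r′) ⟩
    summand e r                            ≡⟨ summand-match eq ⟩
    signZ r *ℤ + matchCount H r            ∎
    where
    other : ∀ r′ → r′ ≢ r → k * r′ + e ≢ n
    other r′ r′≢r eq′ = r′≢r (*-cancelˡ-≡ r′ r k (+-cancelʳ-≡ e _ _ (trans eq′ (sym eq))))

  matchingPoly-nonzero : .{{_ : NonZero k}} → ∀ {e r} (S : Subset m) → PairwiseDisjoint H S →
    ∣ S ∣ ≡ r → k * r + e ≡ n → matchingPoly H e ≢ + 0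
  matchingPoly-nonzero S disj refl eq =
    signZ*-nonzero ∣ S ∣ (matchCount-pos S refl disj) ∘ trans (sym (matchingPoly-coeff (∣p∣≤n S) eq))

  matchingPoly-supportedOnProgression : .{{_ : NonZero k}} →
    SupportedOnProgression (matchingPoly H) (n % k) k (suc (n / k))
  matchingPoly-supportedOnProgression e off = matchingPoly-vanishes λ r eq →
    off (e / k) (s≤s (/-monoˡ-≤ k (subst (e ≤_) eq (m≤n+m e (k * r))))) (k*r+e≡n⇒e≡n%k+k*[e/k] eq)

theorem4p3 : (k : ℕ) → 2 ≤ k → (H : KGraph k) → Connected H → 0 < KGraph.m H →
    IsCyclicIndex (matchingPoly H) k
theorem4p3 k@(suc _) (s≤s _) H _ 0<m = symmetric , maximal
  where
  open KGraph H

  i : Fin m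
  i = fromℕ< 0<m

  k≤n : k ≤ n
  k≤n = edge⇒k≤n H i

  symmetric : Symmetric k (matchingPoly H)
  symmetric = supportedOnProgression⇒symmetric {s = n % k} {L = suc (n / k)} (s≤s z≤n)
    (matchingPoly-supportedOnProgression H)

  x^n-k : matchingPoly H (n ∸ k) ≢ + 0
  x^n-k = matchingPoly-nonzero H ⁅ i ⁆ (⁅⁆-pairwiseDisjoint H i) (∣⁅x⁆∣≡1 i)
    (trans (cong (_+ (n ∸ k)) (*-identityʳ k)) (m+[n∸m]≡n k≤n))

  x^n : matchingPoly H (k + (n ∸ k)) ≢ + 0
  x^n = matchingPoly-nonzero H ⊥ (⊥-pairwiseDisjoint H) (∣⊥∣≡0 m)
    (trans (cong (_+ (k + (n ∸ k))) (*-zeroʳ k)) (m+[n∸m]≡n k≤n))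

  maximal : ∀ ℓ → Symmetric ℓ (matchingPoly H) → ℓ ≤ k
  maximal ℓ ℓ-symmetric = ∣⇒≤ (symmetric⇒∣-gap ℓ-symmetric x^n-k x^n)
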